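{- Let $\mathbf{C}$ be an extensive category with finite products, a stable natural number object $\mathbb{N}$ and exponentials $X^{\mathbb{N}}$. Suppose that (i) $\mathbf{C}$ has countable coproducts and (ii) for every family $(\sigma_i\colon A_i\to A)_{i\in\omega}$ of complemented, pairwise disjoint monomorphisms, the induced morphism $\coprod_i A_i\to A$ is complemented. Then $\hat\iota\colon\mathbb{N}\to\bar{\mathbb{N}}$ is complemented (i.e. $\mathbf{C}$ satisfies LPO), and hence $DX\cong X\times\mathbb{N}+1$ for every object $X$.
   Context: Extensive: finite coproducts exist, are disjoint and stable under pullback. A stable natural number object is $(\mathbb{N},o,s)$ such that for all $f\colon X\to Y$, $g\colon Y\to Y$ there is a unique $h\colon X\times\mathbb{N}\to Y$ with $h\langle\mathrm{id},o\,!\rangle=f$ and $h(\mathrm{id}\times s)=gh$. $DX$ is the final coalgebra of $X+(-)$ with invertible structure $\mathrm{out}$, $\mathrm{now}=\mathrm{out}^{ -1}\mathrm{inl}$, $\mathrm{later}=\mathrm{out}^{ -1}\mathrm{inr}$. $\iota_X\colon X\times\mathbb{N}\to DX$ is given by $\iota_X(x,o)=\mathrm{now}(x)$, $\iota_X(x,s(n))=\mathrm{later}(\iota_X(x,n))$; $\bar{\mathbb{N}}=D1$ and $\hat\iota\colon\mathbb{N}\to\bar{\mathbb{N}}$ is $\iota_1$ precomposed with $\mathbb{N}\cong1\times\mathbb{N}$. A monic $\sigma\colon X\to Y$ is complemented if there is $\sigma'\colon X'\to Y$ exhibiting $Y$ as a coproduct of $X$ and $X'$ with injections $\sigma,\sigma'$.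 -}

module Defs where

-- Categories are
-- setoid-enriched: each hom-type carries an equivalence relation _≈_.
-- "There is a unique h such that ..." is rendered as: a witness h
-- satisfying the equations, and every h' satisfying them is ≈ h.

open import Level using (Level; _⊔_)
open import Data.Nat using (ℕ)
open import Data.Product using (Σ; _×_; _,_; proj₁; proj₂; Σ-syntax)
open import Relation.Binary.PropositionalEquality using (_≢_)
open import Relation.Binary.Structures using (IsEquivalence)

record Category (o ℓ e : Level) : Set (Level.suc (o ⊔ ℓ ⊔ e)) where
  infixr 9 _∘_
  infix 4 _≈_
  field
    Obj : Set o
    Hom : Obj → Obj → Set ℓ
    _≈_ : ∀ {A B} → Hom A B → Hom A B → Set e
    ≈-equiv : ∀ {A B} → IsEquivalence (_≈_ {A} {B})
    id : ∀ {A} → Hom A A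
    _∘_ : ∀ {A B C} → Hom B C → Hom A B → Hom A C
    assoc : ∀ {A B C D} {f : Hom A B} {g : Hom B C} {h : Hom C D} →
            (h ∘ g) ∘ f ≈ h ∘ (g ∘ f)
    identityˡ : ∀ {A B} {f : Hom A B} → id ∘ f ≈ f
    identityʳ : ∀ {A B} {f : Hom A B} → f ∘ id ≈ f
    ∘-resp-≈ : ∀ {A B C} {f h : Hom B C} {g i : Hom A B} →
               f ≈ h → g ≈ i → f ∘ g ≈ h ∘ i

module Definitions {o ℓ e : Level} (𝒞 : Category o ℓ e) where
  open Category 𝒞

  IsInitial : Obj → Set (o ⊔ ℓ ⊔ e)
  IsInitial Z = ∀ Y → Σ[ h ∈ Hom Z Y ] (∀ (h' : Hom Z Y) → h' ≈ h)

  IsTerminal : Obj → Set (o ⊔ ℓ ⊔ e)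
  IsTerminal T = ∀ Y → Σ[ h ∈ Hom Y T ] (∀ (h' : Hom Y T) → h' ≈ h)

  Monic : ∀ {A B} → Hom A B → Set (o ⊔ ℓ ⊔ e)
  Monic {A} f = ∀ {Z} (g h : Hom Z A) → f ∘ g ≈ f ∘ h → g ≈ h

  record Iso (A B : Obj) : Set (ℓ ⊔ e) where
    field
      to      : Hom A B
      from    : Hom B A
      from∘to : from ∘ to ≈ id
      to∘from : to ∘ from ≈ id

  IsCoproduct : ∀ {A B S} → Hom A S → Hom B S → Set (o ⊔ ℓ ⊔ e)
  IsCoproduct {A} {B} {S} i₁ i₂ =
    ∀ {Z} (f : Hom A Z) (g : Hom B Z) →
    Σ[ h ∈ Hom S Z ] ((h ∘ i₁ ≈ f × h ∘ i₂ ≈ g) ×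
                      (∀ (h' : Hom S Z) → h' ∘ i₁ ≈ f → h' ∘ i₂ ≈ g → h' ≈ h))

  IsProduct : ∀ {A B P} → Hom P A → Hom P B → Set (o ⊔ ℓ ⊔ e)
  IsProduct {A} {B} {P} p₁ p₂ =
    ∀ {Z} (f : Hom Z A) (g : Hom Z B) →
    Σ[ h ∈ Hom Z P ] ((p₁ ∘ h ≈ f × p₂ ∘ h ≈ g) ×
                      (∀ (h' : Hom Z P) → p₁ ∘ h' ≈ f → p₂ ∘ h' ≈ g → h' ≈ h))

  IsPullback : ∀ {A B C P} → Hom A C → Hom B C → Hom P A → Hom P B → Set (o ⊔ ℓ ⊔ e)
  IsPullback {A} {B} {C} {P} f g p₁ p₂ =
    (f ∘ p₁ ≈ g ∘ p₂) ×
    (∀ {Q} (q₁ : Hom Q A) (q₂ : Hom Q B) → f ∘ q₁ ≈ g ∘ q₂ →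
     Σ[ u ∈ Hom Q P ] ((p₁ ∘ u ≈ q₁ × p₂ ∘ u ≈ q₂) ×
                       (∀ (u' : Hom Q P) → p₁ ∘ u' ≈ q₁ → p₂ ∘ u' ≈ q₂ → u' ≈ u)))

  Complemented : ∀ {A B} → Hom A B → Set (o ⊔ ℓ ⊔ e)
  Complemented {A} {B} σ =
    Monic σ × (Σ[ A' ∈ Obj ] Σ[ σ' ∈ Hom A' B ] IsCoproduct σ σ')

  record Coproduct (A B : Obj) : Set (o ⊔ ℓ ⊔ e) where
    field
      obj         : Obj
      inl         : Hom A obj
      inr         : Hom B obj
      isCoproduct : IsCoproduct inl inr

  record Product (A B : Obj) : Set (o ⊔ ℓ ⊔ e) where
    field
      obj       : Obj
      π₁        : Hom obj A
      π₂        : Hom obj B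
      isProduct : IsProduct π₁ π₂

  record FiniteCoproducts : Set (o ⊔ ℓ ⊔ e) where
    field
      𝟘         : Obj
      𝟘-initial : IsInitial 𝟘
      coproduct : ∀ A B → Coproduct A B

  record FiniteProducts : Set (o ⊔ ℓ ⊔ e) where
    field
      𝟙          : Obj
      𝟙-terminal : IsTerminal 𝟙
      product    : ∀ A B → Product A B

  module Coprods (fc : FiniteCoproducts) where
    open FiniteCoproducts fc public
    infixr 6 _+_
    _+_ : Obj → Obj → Obj
    A + B = Coproduct.obj (coproduct A B)
    inl : ∀ {A B} → Hom A (A + B)
    inl {A} {B} = Coproduct.inl (coproduct A B)
    inr : ∀ {A B} → Hom B (A + B)
    inr {A} {B} = Coproduct.inr (coproduct A B)
    [_,_] : ∀ {A B Z} → Hom A Z → Hom B Z → Hom (A + B) Z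
    [ f , g ] = proj₁ (Coproduct.isCoproduct (coproduct _ _) f g)
    _+₁_ : ∀ {A B C D} → Hom A C → Hom B D → Hom (A + B) (C + D)
    f +₁ g = [ inl ∘ f , inr ∘ g ]
    ¡ : ∀ {A} → Hom 𝟘 A
    ¡ {A} = proj₁ (𝟘-initial A)

  module Prods (fp : FiniteProducts) where
    open FiniteProducts fp public
    infixr 7 _⊗_
    _⊗_ : Obj → Obj → Obj
    A ⊗ B = Product.obj (product A B)
    π₁ : ∀ {A B} → Hom (A ⊗ B) A
    π₁ {A} {B} = Product.π₁ (product A B)
    π₂ : ∀ {A B} → Hom (A ⊗ B) B
    π₂ {A} {B} = Product.π₂ (product A B)
    ⟨_,_⟩ : ∀ {A B Z} → Hom Z A → Hom Z B → Hom Z (A ⊗ B)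
    ⟨ f , g ⟩ = proj₁ (Product.isProduct (product _ _) f g)
    _×₁_ : ∀ {A B C D} → Hom A C → Hom B D → Hom (A ⊗ B) (C ⊗ D)
    f ×₁ g = ⟨ f ∘ π₁ , g ∘ π₂ ⟩
    ! : ∀ {A} → Hom A 𝟙
    ! {A} = proj₁ (𝟙-terminal A)

  record IsExtensive (fc : FiniteCoproducts) : Set (o ⊔ ℓ ⊔ e) where
    open Coprods fc
    field
      disjoint  : ∀ {A B} → IsPullback (inl {A} {B}) (inr {A} {B}) ¡ ¡
      pullback-inl : ∀ {A B Z} (f : Hom Z (A + B)) →
        Σ[ P ∈ Obj ] Σ[ p ∈ Hom P Z ] Σ[ q ∈ Hom P A ] IsPullback f inl p q
      pullback-inr : ∀ {A B Z} (f : Hom Z (A + B)) →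
        Σ[ P ∈ Obj ] Σ[ p ∈ Hom P Z ] Σ[ q ∈ Hom P B ] IsPullback f inr p q
      stable : ∀ {A B Z} (f : Hom Z (A + B)) {P₁ P₂}
        (p₁ : Hom P₁ Z) (q₁ : Hom P₁ A) (p₂ : Hom P₂ Z) (q₂ : Hom P₂ B) →
        IsPullback f inl p₁ q₁ → IsPullback f inr p₂ q₂ → IsCoproduct p₁ p₂

  record StableNNO (fp : FiniteProducts) : Set (o ⊔ ℓ ⊔ e) where
    open Prods fp
    field
      N   : Obj
      z   : Hom 𝟙 N
      s   : Hom N N
      rec : ∀ {X Y} → Hom X Y → Hom Y Y → Hom (X ⊗ N) Y
      rec-z : ∀ {X Y} (f : Hom X Y) (g : Hom Y Y) →
              rec f g ∘ ⟨ id , z ∘ ! ⟩ ≈ f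
      rec-s : ∀ {X Y} (f : Hom X Y) (g : Hom Y Y) →
              rec f g ∘ (id ×₁ s) ≈ g ∘ rec f g
      rec-unique : ∀ {X Y} (f : Hom X Y) (g : Hom Y Y) (h : Hom (X ⊗ N) Y) →
              h ∘ ⟨ id , z ∘ ! ⟩ ≈ f → h ∘ (id ×₁ s) ≈ g ∘ h → h ≈ rec f g

  record ExponentialN (fp : FiniteProducts) (N X : Obj) : Set (o ⊔ ℓ ⊔ e) where
    open Prods fp
    field
      obj  : Obj
      eval : Hom (obj ⊗ N) X
      curry-universal : ∀ {Y} (f : Hom (Y ⊗ N) X) →
        Σ[ g ∈ Hom Y obj ] ((eval ∘ (g ×₁ id) ≈ f) ×
                            (∀ (g' : Hom Y obj) → eval ∘ (g' ×₁ id) ≈ f → g' ≈ g))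

  HasExponentialsN : (fp : FiniteProducts) → StableNNO fp → Set (o ⊔ ℓ ⊔ e)
  HasExponentialsN fp nno = ∀ X → ExponentialN fp (StableNNO.N nno) X

  record CountableCoproduct (A : ℕ → Obj) : Set (o ⊔ ℓ ⊔ e) where
    field
      obj : Obj
      inj : ∀ i → Hom (A i) obj
      universal : ∀ {Z} (f : ∀ i → Hom (A i) Z) →
        Σ[ h ∈ Hom obj Z ] ((∀ i → h ∘ inj i ≈ f i) ×
                            (∀ (h' : Hom obj Z) → (∀ i → h' ∘ inj i ≈ f i) → h' ≈ h))
    copair : ∀ {Z} (f : ∀ i → Hom (A i) Z) → Hom obj Z
    copair f = proj₁ (universal f)

  CountableCoproducts : Set (o ⊔ ℓ ⊔ e)
  CountableCoproducts = ∀ (A : ℕ → Obj) → CountableCoproduct A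

  CountableUnionsComplemented : FiniteCoproducts → CountableCoproducts → Set (o ⊔ ℓ ⊔ e)
  CountableUnionsComplemented fc cc =
    ∀ (A : ℕ → Obj) (X : Obj) (σ : ∀ i → Hom (A i) X) →
    (∀ i → Complemented (σ i)) →
    (∀ i j → i ≢ j → IsPullback (σ i) (σ j) ¡ ¡) →
    Complemented (CountableCoproduct.copair (cc A) σ)
    where open Coprods fc

  record FinalCoalgebra (fc : FiniteCoproducts) (X : Obj) : Set (o ⊔ ℓ ⊔ e) where
    open Coprods fc
    field
      D      : Obj
      out    : Hom D (X + D)
      out⁻¹  : Hom (X + D) D
      out⁻¹∘out : out⁻¹ ∘ out ≈ id
      out∘out⁻¹ : out ∘ out⁻¹ ≈ id
      unfold : ∀ {Z} (c : Hom Z (X + Z)) →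
        Σ[ h ∈ Hom Z D ] ((out ∘ h ≈ (id +₁ h) ∘ c) ×
                          (∀ (h' : Hom Z D) → out ∘ h' ≈ (id +₁ h') ∘ c → h' ≈ h))
    now : Hom X D
    now = out⁻¹ ∘ inl
    later : Hom D D
    later = out⁻¹ ∘ inr

  ι : (fc : FiniteCoproducts) (fp : FiniteProducts) (nno : StableNNO fp)
      {X : Obj} (DX : FinalCoalgebra fc X) →
      Hom (Prods._⊗_ fp X (StableNNO.N nno)) (FinalCoalgebra.D DX)
  ι fc fp nno DX = StableNNO.rec nno (FinalCoalgebra.now DX) (FinalCoalgebra.later DX)

  ιhat : (fc : FiniteCoproducts) (fp : FiniteProducts) (nno : StableNNO fp)
         (N̄ : FinalCoalgebra fc (FiniteProducts.𝟙 fp)) →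
         Hom (StableNNO.N nno) (FinalCoalgebra.D N̄)
  ιhat fc fp nno N̄ = ι fc fp nno N̄ ∘ Prods.⟨_,_⟩ fp (Prods.! fp) id

-- The maps delay i = laterⁱ ∘ now : X → DX are complemented and pairwise disjoint, so by
-- hypothesis (ii) their copairing m : ∐ᵢ X → DX is complemented, say DX = ∐ᵢ X + C′. The
-- natural number object gives ∐ᵢ X ≅ X × ℕ, under which m becomes ι_X; hence ι_X, and with it
-- ι̂ = ι_1 ∘ ⟨ ! , id ⟩, is complemented. The complement C′ avoids now and, as later ∘ m =
-- m ∘ shift, it lies inside later(C′); finality of DX then collapses C′ onto the diverging
-- computation never : 1 → DX. Conversely never lies in C′: a common point of never and m would
-- be a fixed point of shift on ∐ᵢ X, and counting down along ℕ places such a point in level 0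
-- and in level 1 at once. So C′ ≅ 1 and DX ≅ X × ℕ + 1.
module Submission where

open import Defs
open import Level using (Level; _⊔_)
open import Data.Nat using (ℕ; zero; suc)
open import Data.Product using (_×_; _,_; proj₁; proj₂; Σ-syntax)
open import Data.Empty using (⊥-elim)
open import Relation.Binary.Bundles using (Setoid)
open import Relation.Binary.PropositionalEquality using (_≢_; refl; cong)
open import Relation.Binary.Structures using (IsEquivalence)
import Relation.Binary.Reasoning.Setoid as SetoidReasoning

module HomReasoning {o ℓ e : Level} (𝒞 : Category o ℓ e) where
  open Category 𝒞

  hom-setoid : Obj → Obj → Setoid ℓ e
  hom-setoid A B = record { _≈_ = _≈_ {A} {B} ; isEquivalence = ≈-equiv }

  module _ {A B : Obj} where
    open IsEquivalence (≈-equiv {A} {B}) public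
      using () renaming (refl to ≈-refl; sym to ≈-sym; trans to ≈-trans)
    open SetoidReasoning (hom-setoid A B) public

  infixr 5 _○_
  _○_ : ∀ {A B} {f g h : Hom A B} → f ≈ g → g ≈ h → f ≈ h
  _○_ = ≈-trans

  infixr 6 refl⟩∘⟨_
  infixl 7 _⟩∘⟨refl
  refl⟩∘⟨_ : ∀ {A B C} {f : Hom B C} {g g′ : Hom A B} → g ≈ g′ → f ∘ g ≈ f ∘ g′
  refl⟩∘⟨ p = ∘-resp-≈ ≈-refl p
  _⟩∘⟨refl : ∀ {A B C} {f f′ : Hom B C} {g : Hom A B} → f ≈ f′ → f ∘ g ≈ f′ ∘ g
  p ⟩∘⟨refl = ∘-resp-≈ p ≈-refl

  sym-assoc : ∀ {A B C D} {f : Hom A B} {g : Hom B C} {h : Hom C D} →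
              h ∘ (g ∘ f) ≈ (h ∘ g) ∘ f
  sym-assoc = ≈-sym assoc

  pullˡ : ∀ {A B C D} {a : Hom C D} {b : Hom B C} {c : Hom A B} {d : Hom B D} →
          a ∘ b ≈ d → a ∘ (b ∘ c) ≈ d ∘ c
  pullˡ p = sym-assoc ○ p ⟩∘⟨refl

  pullʳ : ∀ {A B C D} {a : Hom C D} {b : Hom B C} {c : Hom A B} {d : Hom A C} →
          b ∘ c ≈ d → (a ∘ b) ∘ c ≈ a ∘ d
  pullʳ p = assoc ○ refl⟩∘⟨ p

  cancelˡ : ∀ {A B C} {f : Hom B C} {g : Hom C B} {h : Hom A C} →
            f ∘ g ≈ id → f ∘ (g ∘ h) ≈ h
  cancelˡ p = pullˡ p ○ identityˡ

  elimʳ : ∀ {A B} {f : Hom A B} {g : Hom A A} → g ≈ id → f ∘ g ≈ f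
  elimʳ p = refl⟩∘⟨ p ○ identityʳ

module CategoryProperties {o ℓ e : Level} (𝒞 : Category o ℓ e) where
  open Category 𝒞
  open Definitions 𝒞
  open HomReasoning 𝒞

  iterate : ∀ {A} → Hom A A → ℕ → Hom A A
  iterate f zero    = id
  iterate f (suc i) = f ∘ iterate f i

  iterate-commute : ∀ {A} (f : Hom A A) i → f ∘ iterate f i ≈ iterate f i ∘ f
  iterate-commute f zero    = identityʳ ○ ≈-sym identityˡ
  iterate-commute f (suc i) = refl⟩∘⟨ iterate-commute f i ○ sym-assoc

  Monic-∘ : ∀ {A B C} {f : Hom B C} {g : Hom A B} → Monic f → Monic g → Monic (f ∘ g)
  Monic-∘ mf mg x y p = mg x y (mf _ _ (sym-assoc ○ p ○ assoc))

  retraction⇒Monic : ∀ {A B} {f : Hom A B} (r : Hom B A) → r ∘ f ≈ id → Monic f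
  retraction⇒Monic r rf x y p = ≈-sym (cancelˡ rf) ○ refl⟩∘⟨ p ○ cancelˡ rf

  Monic-resp-≈ : ∀ {A B} {f f′ : Hom A B} → f ≈ f′ → Monic f′ → Monic f
  Monic-resp-≈ e M x y p = M x y (≈-sym e ⟩∘⟨refl ○ p ○ e ⟩∘⟨refl)

  Iso-refl : ∀ {A} → Iso A A
  Iso-refl = record { to = id ; from = id ; from∘to = identityˡ ; to∘from = identityˡ }

  Iso-sym : ∀ {A B} → Iso A B → Iso B A
  Iso-sym i = record { to = from ; from = to ; from∘to = to∘from ; to∘from = from∘to }
    where open Iso i

  Iso⇒Monic : ∀ {A B} (i : Iso A B) → Monic (Iso.to i)
  Iso⇒Monic i = retraction⇒Monic (Iso.from i) (Iso.from∘to i)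

  module Copairing {A B S} {a : Hom A S} {b : Hom B S} (isc : IsCoproduct a b) where
    copair : ∀ {Z} → Hom A Z → Hom B Z → Hom S Z
    copair f g = proj₁ (isc f g)

    copair-inj₁ : ∀ {Z} {f : Hom A Z} {g : Hom B Z} → copair f g ∘ a ≈ f
    copair-inj₁ {f = f} {g} = proj₁ (proj₁ (proj₂ (isc f g)))

    copair-inj₂ : ∀ {Z} {f : Hom A Z} {g : Hom B Z} → copair f g ∘ b ≈ g
    copair-inj₂ {f = f} {g} = proj₂ (proj₁ (proj₂ (isc f g)))

    copair-unique : ∀ {Z} {f : Hom A Z} {g : Hom B Z} (h : Hom S Z) →
                    h ∘ a ≈ f → h ∘ b ≈ g → h ≈ copair f g
    copair-unique {f = f} {g} = proj₂ (proj₂ (isc f g))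

    jointly-epic : ∀ {Z} {h h′ : Hom S Z} → h ∘ a ≈ h′ ∘ a → h ∘ b ≈ h′ ∘ b → h ≈ h′
    jointly-epic {h = h} {h′} p q = copair-unique h p q ○ ≈-sym (copair-unique h′ ≈-refl ≈-refl)

  IsCoproduct-swap : ∀ {A B S} {a : Hom A S} {b : Hom B S} → IsCoproduct a b → IsCoproduct b a
  IsCoproduct-swap isc f g =
    copair g f , (copair-inj₂ , copair-inj₁) , λ h p q → copair-unique h q p
    where open Copairing isc

  IsCoproduct-resp-≈ : ∀ {A B S} {a a′ : Hom A S} {b : Hom B S} →
                       a′ ≈ a → IsCoproduct a b → IsCoproduct a′ b
  IsCoproduct-resp-≈ e isc f g =
    copair f g , (refl⟩∘⟨ e ○ copair-inj₁ , copair-inj₂) ,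
    λ h p q → copair-unique h (refl⟩∘⟨ ≈-sym e ○ p) q
    where open Copairing isc

  IsCoproduct-transport : ∀ {A B S T} {a : Hom A S} {b : Hom B S} → IsCoproduct a b →
                          (i : Iso S T) → IsCoproduct (Iso.to i ∘ a) (Iso.to i ∘ b)
  IsCoproduct-transport isc i f g =
    copair f g ∘ from ,
    (pullʳ (cancelˡ from∘to) ○ copair-inj₁ , pullʳ (cancelˡ from∘to) ○ copair-inj₂) ,
    λ h p q → ≈-sym (elimʳ to∘from) ○ sym-assoc
              ○ copair-unique (h ∘ to) (assoc ○ p) (assoc ○ q) ⟩∘⟨refl
    where open Copairing isc
          open Iso i

  IsCoproduct-reindex : ∀ {A A′ B S} {a : Hom A S} {b : Hom B S} → IsCoproduct a b →
                        (i : Iso A′ A) → IsCoproduct (a ∘ Iso.to i) b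
  IsCoproduct-reindex isc i f g =
    copair (f ∘ from) g , (sym-assoc ○ copair-inj₁ ⟩∘⟨refl ○ assoc ○ elimʳ from∘to , copair-inj₂) ,
    λ h p q → copair-unique h (≈-sym (elimʳ to∘from) ○ sym-assoc ○ (assoc ○ p) ⟩∘⟨refl) q
    where open Copairing isc
          open Iso i

  Complemented-resp-≈ : ∀ {A S} {a a′ : Hom A S} → a′ ≈ a → Complemented a → Complemented a′
  Complemented-resp-≈ e (M , _ , b , isc) = Monic-resp-≈ e M , _ , b , IsCoproduct-resp-≈ e isc

  Complemented-∘-Iso : ∀ {A A′ S} {a : Hom A S} → Complemented a →
                       (i : Iso A′ A) → Complemented (a ∘ Iso.to i)
  Complemented-∘-Iso (M , _ , b , isc) i =
    Monic-∘ M (Iso⇒Monic i) , _ , b , IsCoproduct-reindex isc i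

module FiniteCoproductProperties {o ℓ e : Level} (𝒞 : Category o ℓ e)
  (fc : Definitions.FiniteCoproducts 𝒞) where
  open Category 𝒞
  open Definitions 𝒞
  open Coprods fc
  open HomReasoning 𝒞
  open CategoryProperties 𝒞

  ¡-unique₂ : ∀ {A} (h h′ : Hom 𝟘 A) → h ≈ h′
  ¡-unique₂ {A} h h′ = proj₂ (𝟘-initial A) h ○ ≈-sym (proj₂ (𝟘-initial A) h′)

  +-isCoproduct : ∀ {A B} → IsCoproduct (inl {A} {B}) inr
  +-isCoproduct = Coproduct.isCoproduct (coproduct _ _)

  module +-Copairing {A B} = Copairing (+-isCoproduct {A} {B})

  []-inl : ∀ {A B Z} {f : Hom A Z} {g : Hom B Z} → [ f , g ] ∘ inl ≈ f
  []-inl = +-Copairing.copair-inj₁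

  []-inr : ∀ {A B Z} {f : Hom A Z} {g : Hom B Z} → [ f , g ] ∘ inr ≈ g
  []-inr = +-Copairing.copair-inj₂

  IsCoproduct⇒Iso : ∀ {A A′ B B′ S} {a : Hom A S} {b : Hom B S} → IsCoproduct a b →
                    Iso A A′ → Iso B B′ → Iso S (A′ + B′)
  IsCoproduct⇒Iso {a = a} {b} isc i j = record
    { to      = copair (inl ∘ Iso.to i) (inr ∘ Iso.to j)
    ; from    = [ a ∘ Iso.from i , b ∘ Iso.from j ]
    ; from∘to = jointly-epic
        (pullʳ copair-inj₁ ○ pullˡ []-inl ○ pullʳ (Iso.from∘to i) ○ identityʳ ○ ≈-sym identityˡ)
        (pullʳ copair-inj₂ ○ pullˡ []-inr ○ pullʳ (Iso.from∘to j) ○ identityʳ ○ ≈-sym identityˡ)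
    ; to∘from = +-Copairing.jointly-epic
        (pullʳ []-inl ○ pullˡ copair-inj₁ ○ pullʳ (Iso.to∘from i) ○ identityʳ ○ ≈-sym identityˡ)
        (pullʳ []-inr ○ pullˡ copair-inj₂ ○ pullʳ (Iso.to∘from j) ○ identityʳ ○ ≈-sym identityˡ)
    }
    where open Copairing isc

  IsCoproduct-∘ : ∀ {A B P S T} {a : Hom A S} {b : Hom B S} {q : Hom S T} {p : Hom P T} →
                  IsCoproduct q p → IsCoproduct a b → IsCoproduct (q ∘ a) [ p , q ∘ b ]
  IsCoproduct-∘ {a = a} {b} {q} {p} iqp iab f g =
    h , (h∘qa , h∘[p,qb]) , unique
    where
      module QP = Copairing iqp
      module AB = Copairing iab
      h = QP.copair (AB.copair f (g ∘ inr)) (g ∘ inl)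
      h∘qa : h ∘ (q ∘ a) ≈ f
      h∘qa = pullˡ QP.copair-inj₁ ○ AB.copair-inj₁
      h∘[p,qb] : h ∘ [ p , q ∘ b ] ≈ g
      h∘[p,qb] = +-Copairing.jointly-epic
        (pullʳ []-inl ○ QP.copair-inj₂)
        (pullʳ []-inr ○ pullˡ QP.copair-inj₁ ○ AB.copair-inj₂)
      unique : ∀ h′ → h′ ∘ (q ∘ a) ≈ f → h′ ∘ [ p , q ∘ b ] ≈ g → h′ ≈ h
      unique h′ eqa eqg = QP.copair-unique h′
        (AB.copair-unique (h′ ∘ q) (assoc ○ eqa) (assoc ○ refl⟩∘⟨ ≈-sym []-inr ○ pullˡ eqg))
        (refl⟩∘⟨ ≈-sym []-inl ○ pullˡ eqg)

  Complemented-∘ : ∀ {A B C} {g : Hom B C} {f : Hom A B} →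
                   Complemented g → Complemented f → Complemented (g ∘ f)
  Complemented-∘ {g = g} (Mg , _ , p , iqp) (Mf , _ , b , iab) =
    Monic-∘ Mg Mf , _ , [ p , g ∘ b ] , IsCoproduct-∘ iqp iab

module ExtensiveProperties {o ℓ e : Level} (𝒞 : Category o ℓ e)
  (fc : Definitions.FiniteCoproducts 𝒞) (ext : Definitions.IsExtensive 𝒞 fc) where
  open Category 𝒞
  open Definitions 𝒞
  open Coprods fc
  open IsExtensive ext
  open HomReasoning 𝒞
  open CategoryProperties 𝒞
  open FiniteCoproductProperties 𝒞 fc

  -- Disjointness as "every cone over f and g has empty apex" rather than "the pullback
  -- of f and g is 𝟘"; the two agree because 𝟘 is strict (Disjoint⇒IsPullback).
  Disjoint : ∀ {A B C} → Hom A C → Hom B C → Set (o ⊔ ℓ ⊔ e)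
  Disjoint {A} {B} f g = ∀ {Q} (x : Hom Q A) (y : Hom Q B) → f ∘ x ≈ g ∘ y → Hom Q 𝟘

  Disjoint-sym : ∀ {A B C} {f : Hom A C} {g : Hom B C} → Disjoint f g → Disjoint g f
  Disjoint-sym d x y p = d y x (≈-sym p)

  inl-inr-disjoint : ∀ {A B} → Disjoint (inl {A} {B}) inr
  inl-inr-disjoint x y p = proj₁ (proj₂ disjoint x y p)

  module Pullback {A B C P} {f : Hom A C} {g : Hom B C} {p : Hom P A} {q : Hom P B}
                  (pb : IsPullback f g p q) where
    mediate : ∀ {Q} (x : Hom Q A) (y : Hom Q B) → f ∘ x ≈ g ∘ y → Hom Q P
    mediate x y eq = proj₁ (proj₂ pb x y eq)

    p∘mediate : ∀ {Q} {x : Hom Q A} {y : Hom Q B} (eq : f ∘ x ≈ g ∘ y) → p ∘ mediate x y eq ≈ x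
    p∘mediate {x = x} {y} eq = proj₁ (proj₁ (proj₂ (proj₂ pb x y eq)))

    q∘mediate : ∀ {Q} {x : Hom Q A} {y : Hom Q B} (eq : f ∘ x ≈ g ∘ y) → q ∘ mediate x y eq ≈ y
    q∘mediate {x = x} {y} eq = proj₂ (proj₁ (proj₂ (proj₂ pb x y eq)))

  -- Pulling inl back along itself gives a coproduct with the empty pullback
  -- of inl along inr, so the projection p is split monic; mediating maps into
  -- the pullback are therefore determined by their p-component.
  inl-monic : ∀ {A B} → Monic (inl {A} {B})
  inl-monic {A} {B} g h eq with pullback-inl (inl {A} {B})
  ... | _ , p , q , pb = begin
    g                      ≈⟨ q∘mediate ≈-refl ⟨
    q ∘ mediate g g ≈-refl ≈⟨ refl⟩∘⟨ p-monic _ _ (p∘mediate ≈-refl ○ ≈-sym (p∘mediate eq)) ⟩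
    q ∘ mediate g h eq     ≈⟨ q∘mediate eq ⟩
    h                      ∎
    where
      open Pullback pb
      p-monic : Monic p
      p-monic = retraction⇒Monic _
        (Copairing.copair-inj₁ (stable inl p q ¡ ¡ pb disjoint) {f = id} {g = ¡})

  inr-monic : ∀ {A B} → Monic (inr {A} {B})
  inr-monic {A} {B} = Monic-resp-≈ (≈-sym []-inl) (Monic-∘ swap-monic inl-monic)
    where
      swap-monic : Monic {B + A} {A + B} [ inr , inl ]
      swap-monic = retraction⇒Monic [ inr , inl ] (+-Copairing.jointly-epic
        (pullʳ []-inl ○ []-inr ○ ≈-sym identityˡ)
        (pullʳ []-inr ○ []-inl ○ ≈-sym identityˡ))

  IsPullback-along-monic : ∀ {A B C} {f : Hom A C} {g : Hom B C} {w : Hom A B} →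
                           Monic g → f ≈ g ∘ w → IsPullback f g id w
  IsPullback-along-monic M e =
    identityʳ ○ e ,
    λ q₁ q₂ eq → q₁ , (identityˡ , M _ _ (sym-assoc ○ ≈-sym e ⟩∘⟨refl ○ eq)) ,
                 λ u p _ → ≈-sym identityˡ ○ p

  -- The pullbacks of inl ∘ w along inl and along inr (where inl ≈ inr, as
  -- 𝟘 is initial) both have apex Q, so Q is a coproduct of itself with itself
  -- via the identities.
  𝟘-strict : ∀ {Q} → Hom Q 𝟘 → ∀ {Y} (g h : Hom Q Y) → g ≈ h
  𝟘-strict w g h = ≈-sym copair-inj₁ ○ copair-inj₂
    where
      open Copairing (stable (inl ∘ w) id w id w
        (IsPullback-along-monic inl-monic ≈-refl)
        (IsPullback-along-monic inr-monic (¡-unique₂ inl inr ⟩∘⟨refl)))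

  Disjoint⇒IsPullback : ∀ {A B C} {f : Hom A C} {g : Hom B C} → Disjoint f g → IsPullback f g ¡ ¡
  Disjoint⇒IsPullback d =
    ¡-unique₂ _ _ ,
    λ q₁ q₂ eq → let w = d q₁ q₂ eq in
      w , (𝟘-strict w _ _ , 𝟘-strict w _ _) , λ u _ _ → 𝟘-strict w u w

  IsCoproduct⇒Disjoint : ∀ {A B S} {a : Hom A S} {b : Hom B S} → IsCoproduct a b → Disjoint a b
  IsCoproduct⇒Disjoint isc x y eq =
    inl-inr-disjoint x y (≈-sym (pullˡ copair-inj₁) ○ refl⟩∘⟨ eq ○ pullˡ copair-inj₂)
    where open Copairing isc

  IsCoproduct⇒Monic₁ : ∀ {A B S} {a : Hom A S} {b : Hom B S} → IsCoproduct a b → Monic a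
  IsCoproduct⇒Monic₁ isc =
    Monic-resp-≈ (≈-sym ([]-inl ○ identityʳ)) (Monic-∘ (Iso⇒Monic (Iso-sym S≅A+B)) inl-monic)
    where S≅A+B = IsCoproduct⇒Iso isc Iso-refl Iso-refl

  IsCoproduct⇒Monic₂ : ∀ {A B S} {a : Hom A S} {b : Hom B S} → IsCoproduct a b → Monic b
  IsCoproduct⇒Monic₂ isc = IsCoproduct⇒Monic₁ (IsCoproduct-swap isc)

  IsCoproduct⇒Complemented₁ : ∀ {A B S} {a : Hom A S} {b : Hom B S} →
                              IsCoproduct a b → Complemented a
  IsCoproduct⇒Complemented₁ isc = IsCoproduct⇒Monic₁ isc , _ , _ , isc

  IsCoproduct⇒Complemented₂ : ∀ {A B S} {a : Hom A S} {b : Hom B S} →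
                              IsCoproduct a b → Complemented b
  IsCoproduct⇒Complemented₂ isc = IsCoproduct⇒Complemented₁ (IsCoproduct-swap isc)

  empty-summand⇒split-epi : ∀ {P₁ P₂ W} {p₁ : Hom P₁ W} {p₂ : Hom P₂ W} → IsCoproduct p₁ p₂ →
                            Hom P₁ 𝟘 → Σ[ k ∈ Hom W P₂ ] p₂ ∘ k ≈ id
  empty-summand⇒split-epi isc w =
    copair (¡ ∘ w) id ,
    jointly-epic (𝟘-strict w _ _) (pullʳ copair-inj₂ ○ identityʳ ○ ≈-sym identityˡ)
    where open Copairing isc

  -- Extensivity splits W along the pullbacks of g; the inl-part is empty.
  factor-through-inr : ∀ {A B W} (g : Hom W (A + B)) → Disjoint g inl → Σ[ v ∈ Hom W B ] g ≈ inr ∘ v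
  factor-through-inr g d with pullback-inl g | pullback-inr g
  ... | _ , p₁ , q₁ , pb₁ | _ , p₂ , q₂ , pb₂
    with empty-summand⇒split-epi (stable g p₁ q₁ p₂ q₂ pb₁ pb₂) (d p₁ q₁ (proj₁ pb₁))
  ... | k , p₂∘k≈id = q₂ ∘ k , (≈-sym (elimʳ p₂∘k≈id) ○ pullˡ (proj₁ pb₂) ○ assoc)

  factor-through-complement : ∀ {A B S W} {a : Hom A S} {b : Hom B S} → IsCoproduct a b →
                              (f : Hom W S) → Disjoint f a → Σ[ v ∈ Hom W B ] f ≈ b ∘ v
  factor-through-complement isc f d =
    proj₁ to∘f-factors ,
    (≈-sym (cancelˡ from∘to) ○ refl⟩∘⟨ proj₂ to∘f-factors ○ pullˡ ([]-inr ○ identityʳ))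
    where
      open Iso (IsCoproduct⇒Iso isc Iso-refl Iso-refl)
      to∘f-disjoint : Disjoint (to ∘ f) inl
      to∘f-disjoint x y eq =
        d x y (≈-sym (cancelˡ from∘to) ○ refl⟩∘⟨ (sym-assoc ○ eq) ○ pullˡ ([]-inl ○ identityʳ))
      to∘f-factors = factor-through-inr (to ∘ f) to∘f-disjoint

module ProductProperties {o ℓ e : Level} (𝒞 : Category o ℓ e)
  (fp : Definitions.FiniteProducts 𝒞) where
  open Category 𝒞
  open Definitions 𝒞
  open Prods fp
  open HomReasoning 𝒞

  !-unique₂ : ∀ {A} (h h′ : Hom A 𝟙) → h ≈ h′
  !-unique₂ {A} h h′ = proj₂ (𝟙-terminal A) h ○ ≈-sym (proj₂ (𝟙-terminal A) h′)

  module _ {A B Z : Obj} {f : Hom Z A} {g : Hom Z B} where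
    private universal = Product.isProduct (product A B) f g

    π₁∘⟨⟩ : π₁ ∘ ⟨ f , g ⟩ ≈ f
    π₁∘⟨⟩ = proj₁ (proj₁ (proj₂ universal))

    π₂∘⟨⟩ : π₂ ∘ ⟨ f , g ⟩ ≈ g
    π₂∘⟨⟩ = proj₂ (proj₁ (proj₂ universal))

    ⟨⟩-unique : (h : Hom Z (A ⊗ B)) → π₁ ∘ h ≈ f → π₂ ∘ h ≈ g → h ≈ ⟨ f , g ⟩
    ⟨⟩-unique = proj₂ (proj₂ universal)

  ⟨⟩-cong : ∀ {A B Z} {f f′ : Hom Z A} {g g′ : Hom Z B} → f ≈ f′ → g ≈ g′ → ⟨ f , g ⟩ ≈ ⟨ f′ , g′ ⟩
  ⟨⟩-cong p q = ⟨⟩-unique _ (π₁∘⟨⟩ ○ p) (π₂∘⟨⟩ ○ q)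

  ⟨⟩∘ : ∀ {A B Y Z} {f : Hom Z A} {g : Hom Z B} {h : Hom Y Z} → ⟨ f , g ⟩ ∘ h ≈ ⟨ f ∘ h , g ∘ h ⟩
  ⟨⟩∘ = ⟨⟩-unique _ (pullˡ π₁∘⟨⟩) (pullˡ π₂∘⟨⟩)

  ×₁∘⟨⟩ : ∀ {A B C D Z} {f : Hom A C} {g : Hom B D} {a : Hom Z A} {b : Hom Z B} →
          (f ×₁ g) ∘ ⟨ a , b ⟩ ≈ ⟨ f ∘ a , g ∘ b ⟩
  ×₁∘⟨⟩ = ⟨⟩∘ ○ ⟨⟩-cong (pullʳ π₁∘⟨⟩) (pullʳ π₂∘⟨⟩)

  ×₁∘×₁ : ∀ {A B C D E F} {f : Hom C E} {g : Hom D F} {h : Hom A C} {k : Hom B D} →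
          (f ×₁ g) ∘ (h ×₁ k) ≈ (f ∘ h) ×₁ (g ∘ k)
  ×₁∘×₁ = ×₁∘⟨⟩ ○ ⟨⟩-cong sym-assoc sym-assoc

  ⟨id,const⟩∘ : ∀ {A B C} {c : Hom 𝟙 C} {u : Hom A B} → ⟨ id , c ∘ ! ⟩ ∘ u ≈ ⟨ u , c ∘ ! ⟩
  ⟨id,const⟩∘ = ⟨⟩∘ ○ ⟨⟩-cong identityˡ (assoc ○ refl⟩∘⟨ !-unique₂ _ _)

  ×₁id∘⟨id,⟩ : ∀ {A B C} {u : Hom A B} {c : Hom A C} → (u ×₁ id) ∘ ⟨ id , c ⟩ ≈ ⟨ u , c ⟩
  ×₁id∘⟨id,⟩ = ×₁∘⟨⟩ ○ ⟨⟩-cong identityʳ identityˡ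

module NNOProperties {o ℓ e : Level} (𝒞 : Category o ℓ e)
  (fp : Definitions.FiniteProducts 𝒞) (nno : Definitions.StableNNO 𝒞 fp) where
  open Category 𝒞
  open Definitions 𝒞
  open Prods fp
  open StableNNO nno
  open HomReasoning 𝒞
  open CategoryProperties 𝒞
  open ProductProperties 𝒞 fp

  N≅𝟙⊗N : Iso N (𝟙 ⊗ N)
  N≅𝟙⊗N = record
    { to      = ⟨ ! , id ⟩
    ; from    = π₂
    ; from∘to = π₂∘⟨⟩
    ; to∘from = ⟨⟩∘ ○ ≈-sym (⟨⟩-unique id (identityʳ ○ !-unique₂ _ _) (identityʳ ○ ≈-sym identityˡ))
    }

  numeral : ℕ → Hom 𝟙 N
  numeral zero    = z
  numeral (suc i) = s ∘ numeral i

  rec-numeral : ∀ {X Y} (f : Hom X Y) (g : Hom Y Y) i →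
                rec f g ∘ ⟨ id , numeral i ∘ ! ⟩ ≈ iterate g i ∘ f
  rec-numeral f g zero    = rec-z f g ○ ≈-sym identityˡ
  rec-numeral f g (suc i) = begin
    rec f g ∘ ⟨ id , (s ∘ numeral i) ∘ ! ⟩           ≈⟨ refl⟩∘⟨ step ⟩
    rec f g ∘ ((id ×₁ s) ∘ ⟨ id , numeral i ∘ ! ⟩)   ≈⟨ pullˡ (rec-s f g) ⟩
    (g ∘ rec f g) ∘ ⟨ id , numeral i ∘ ! ⟩           ≈⟨ pullʳ (rec-numeral f g i) ⟩
    g ∘ (iterate g i ∘ f)                            ≈⟨ sym-assoc ⟩
    iterate g (suc i) ∘ f                            ∎
    where
      step : ⟨ id , (s ∘ numeral i) ∘ ! ⟩ ≈ (id ×₁ s) ∘ ⟨ id , numeral i ∘ ! ⟩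
      step = ⟨⟩-cong (≈-sym identityˡ) assoc ○ ≈-sym ×₁∘⟨⟩

  rec-unique₂ : ∀ {X Y} {g : Hom Y Y} {h h′ : Hom (X ⊗ N) Y} →
                h ∘ ⟨ id , z ∘ ! ⟩ ≈ h′ ∘ ⟨ id , z ∘ ! ⟩ →
                h ∘ (id ×₁ s) ≈ g ∘ h → h′ ∘ (id ×₁ s) ≈ g ∘ h′ → h ≈ h′
  rec-unique₂ {g = g} {h} {h′} base step step′ =
    rec-unique _ g h base step ○ ≈-sym (rec-unique _ g h′ ≈-refl step′)

  rec-natural : ∀ {W X Y} (f : Hom X Y) (g : Hom Y Y) (u : Hom W X) →
                rec f g ∘ (u ×₁ id) ≈ rec (f ∘ u) g
  rec-natural f g u = rec-unique (f ∘ u) g _ base step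
    where
      base : (rec f g ∘ (u ×₁ id)) ∘ ⟨ id , z ∘ ! ⟩ ≈ f ∘ u
      base = pullʳ (×₁id∘⟨id,⟩ ○ ≈-sym ⟨id,const⟩∘) ○ pullˡ (rec-z f g)
      u×id-commutes : (u ×₁ id) ∘ (id ×₁ s) ≈ (id ×₁ s) ∘ (u ×₁ id)
      u×id-commutes = ×₁∘×₁
                    ○ ⟨⟩-cong ((identityʳ ○ ≈-sym identityˡ) ⟩∘⟨refl)
                              ((identityˡ ○ ≈-sym identityʳ) ⟩∘⟨refl)
                    ○ ≈-sym ×₁∘×₁
      step : (rec f g ∘ (u ×₁ id)) ∘ (id ×₁ s) ≈ g ∘ (rec f g ∘ (u ×₁ id))
      step = pullʳ u×id-commutes ○ pullˡ (rec-s f g) ○ assoc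

  rec-const : ∀ {X Y} {f : Hom X Y} {g : Hom Y Y} → g ∘ f ≈ f → rec f g ≈ f ∘ π₁
  rec-const {f = f} {g} gf≈f = ≈-sym (rec-unique f g (f ∘ π₁) base step)
    where
      base : (f ∘ π₁) ∘ ⟨ id , z ∘ ! ⟩ ≈ f
      base = pullʳ π₁∘⟨⟩ ○ identityʳ
      step : (f ∘ π₁) ∘ (id ×₁ s) ≈ g ∘ (f ∘ π₁)
      step = pullʳ π₁∘⟨⟩ ○ refl⟩∘⟨ identityˡ ○ ≈-sym (pullˡ gf≈f)

module ConstantCoproduct {o ℓ e : Level} (𝒞 : Category o ℓ e) {X : Category.Obj 𝒞}
  (K : Definitions.CountableCoproduct 𝒞 (λ _ → X)) where
  open Category 𝒞
  open HomReasoning 𝒞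
  open CategoryProperties 𝒞
  open Definitions.CountableCoproduct K public renaming (obj to ∐)

  copair-inj : ∀ {Z} {f : ℕ → Hom X Z} i → copair f ∘ inj i ≈ f i
  copair-inj {f = f} = proj₁ (proj₂ (universal f))

  ∐-jointly-epic : ∀ {Z} {h h′ : Hom ∐ Z} → (∀ i → h ∘ inj i ≈ h′ ∘ inj i) → h ≈ h′
  ∐-jointly-epic {h = h} {h′} p = unique h p ○ ≈-sym (unique h′ (λ _ → ≈-refl))
    where unique = proj₂ (proj₂ (universal (λ i → h′ ∘ inj i)))

  ∇ : Hom ∐ X
  ∇ = copair (λ _ → id)

  shift : Hom ∐ ∐
  shift = copair (λ i → inj (suc i))

  pred : Hom ∐ ∐
  pred = copair λ { zero → inj zero ; (suc i) → inj i }

  pred∘shift : pred ∘ shift ≈ id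
  pred∘shift = ∐-jointly-epic λ i → pullʳ (copair-inj i) ○ copair-inj (suc i) ○ ≈-sym identityˡ

  iterate-shift-inj₀ : ∀ i → iterate shift i ∘ inj 0 ≈ inj i
  iterate-shift-inj₀ zero    = identityˡ
  iterate-shift-inj₀ (suc i) = pullʳ (iterate-shift-inj₀ i) ○ copair-inj i

  iterate-pred-inj : ∀ i → iterate pred i ∘ inj i ≈ inj 0
  iterate-pred-inj zero    = identityˡ
  iterate-pred-inj (suc i) =
    iterate-commute pred i ⟩∘⟨refl ○ pullʳ (copair-inj (suc i)) ○ iterate-pred-inj i

module ConstantCoproductNNO {o ℓ e : Level} (𝒞 : Category o ℓ e)
  (fp : Definitions.FiniteProducts 𝒞) (nno : Definitions.StableNNO 𝒞 fp) {X : Category.Obj 𝒞}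
  (K : Definitions.CountableCoproduct 𝒞 (λ _ → X)) where
  open Category 𝒞
  open Definitions 𝒞
  open Prods fp
  open StableNNO nno
  open HomReasoning 𝒞
  open ProductProperties 𝒞 fp
  open NNOProperties 𝒞 fp nno
  open ConstantCoproduct 𝒞 K

  X⊗N≅∐ : Iso (X ⊗ N) ∐
  X⊗N≅∐ = record
    { to      = to
    ; from    = from
    ; from∘to = rec-unique₂ {g = id ×₁ s}
        (pullʳ (rec-z _ _) ○ copair-inj 0 ○ ≈-sym identityˡ)
        (pullʳ (rec-s _ _) ○ pullˡ from∘shift ○ assoc)
        (identityˡ ○ ≈-sym identityʳ)
    ; to∘from = ∐-jointly-epic λ i → pullʳ (copair-inj i) ○ to∘point i ○ ≈-sym identityˡ
    }
    where
      to : Hom (X ⊗ N) ∐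
      to = rec (inj 0) shift
      from : Hom ∐ (X ⊗ N)
      from = copair (λ i → ⟨ id , numeral i ∘ ! ⟩)
      to∘point : ∀ i → to ∘ ⟨ id , numeral i ∘ ! ⟩ ≈ inj i
      to∘point i = rec-numeral (inj 0) shift i ○ iterate-shift-inj₀ i
      from∘shift : from ∘ shift ≈ (id ×₁ s) ∘ from
      from∘shift = ∐-jointly-epic λ i →
        pullʳ (copair-inj i) ○ copair-inj (suc i)
        ○ ⟨⟩-cong (≈-sym identityˡ) assoc ○ ≈-sym ×₁∘⟨⟩ ○ ≈-sym (pullʳ (copair-inj i))

module ShiftFixpoints {o ℓ e : Level} (𝒞 : Category o ℓ e)
  (fc : Definitions.FiniteCoproducts 𝒞) (ext : Definitions.IsExtensive 𝒞 fc)
  (fp : Definitions.FiniteProducts 𝒞) (nno : Definitions.StableNNO 𝒞 fp) {X : Category.Obj 𝒞}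
  (K : Definitions.CountableCoproduct 𝒞 (λ _ → X)) where
  open Category 𝒞
  open Definitions 𝒞
  open Coprods fc
  open Prods fp
  open StableNNO nno
  open HomReasoning 𝒞
  open CategoryProperties 𝒞
  open ExtensiveProperties 𝒞 fc ext
  open ProductProperties 𝒞 fp
  open NNOProperties 𝒞 fp nno
  open ConstantCoproduct 𝒞 K

  inj₀-shift-disjoint : Disjoint (inj 0) shift
  inj₀-shift-disjoint x y eq = inl-inr-disjoint x (∇ ∘ y) (begin
    inl ∘ x                 ≈⟨ pullˡ (copair-inj 0) ⟨
    separate ∘ (inj 0 ∘ x)  ≈⟨ refl⟩∘⟨ eq ⟩
    separate ∘ (shift ∘ y)  ≈⟨ pullˡ separate∘shift ⟩
    (inr ∘ ∇) ∘ y           ≈⟨ assoc ⟩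
    inr ∘ (∇ ∘ y)           ∎)
    where
      separate : Hom ∐ (X + X)
      separate = copair λ { zero → inl ; (suc _) → inr }
      separate∘shift : separate ∘ shift ≈ inr ∘ ∇
      separate∘shift = ∐-jointly-epic λ i →
        pullʳ (copair-inj i) ○ copair-inj (suc i) ○ ≈-sym (pullʳ (copair-inj i) ○ identityʳ)

  index : Hom ∐ N
  index = copair (λ i → numeral i ∘ !)

  countdown : Hom (∐ ⊗ N) ∐
  countdown = rec id pred

  countdown-index : countdown ∘ ⟨ id , index ⟩ ≈ inj 0 ∘ ∇
  countdown-index = ∐-jointly-epic λ i → begin
    (countdown ∘ ⟨ id , index ⟩) ∘ inj i          ≈⟨ pullʳ (⟨⟩∘ ○ ⟨⟩-cong identityˡ (copair-inj i)) ⟩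
    countdown ∘ ⟨ inj i , numeral i ∘ ! ⟩         ≈⟨ refl⟩∘⟨ ⟨id,const⟩∘ ⟨
    countdown ∘ (⟨ id , numeral i ∘ ! ⟩ ∘ inj i)  ≈⟨ pullˡ (rec-numeral id pred i) ⟩
    (iterate pred i ∘ id) ∘ inj i                 ≈⟨ pullʳ identityˡ ○ iterate-pred-inj i ⟩
    inj 0                                         ≈⟨ pullʳ (copair-inj i) ○ identityʳ ⟨
    (inj 0 ∘ ∇) ∘ inj i                           ∎

  countdown-pred-invariant : ∀ {Q} {u : Hom Q ∐} → pred ∘ u ≈ u → countdown ∘ (u ×₁ id) ≈ u ∘ π₁
  countdown-pred-invariant pred∘u≈u =
    rec-natural id pred _
    ○ rec-const (refl⟩∘⟨ identityˡ ○ pred∘u≈u ○ ≈-sym identityˡ)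
    ○ identityˡ ⟩∘⟨refl

  -- Counting u down for index u steps lands in level 0 and, by invariance, does not move u.
  pred-invariant⇒level-0 : ∀ {Q} {u : Hom Q ∐} → pred ∘ u ≈ u → u ≈ inj 0 ∘ (∇ ∘ u)
  pred-invariant⇒level-0 {u = u} pred∘u≈u = begin
    u                                             ≈⟨ pullʳ π₁∘⟨⟩ ○ identityʳ ⟨
    (u ∘ π₁) ∘ ⟨ id , index ∘ u ⟩                 ≈⟨ countdown-pred-invariant pred∘u≈u ⟩∘⟨refl ⟨
    (countdown ∘ (u ×₁ id)) ∘ ⟨ id , index ∘ u ⟩  ≈⟨ pullʳ ×₁id∘⟨id,⟩ ⟩
    countdown ∘ ⟨ u , index ∘ u ⟩                 ≈⟨ refl⟩∘⟨ (⟨⟩∘ ○ ⟨⟩-cong identityˡ ≈-refl) ⟨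
    countdown ∘ (⟨ id , index ⟩ ∘ u)              ≈⟨ pullˡ countdown-index ○ assoc ⟩
    inj 0 ∘ (∇ ∘ u)                               ∎

  shift-fixpoint⇒empty : ∀ {Q} (u : Hom Q ∐) → shift ∘ u ≈ u → Hom Q 𝟘
  shift-fixpoint⇒empty u shift∘u≈u =
    inj₀-shift-disjoint (∇ ∘ u) (inj 0 ∘ (∇ ∘ u))
      (≈-sym u-at-level-0 ○ ≈-sym shift∘u≈u ○ refl⟩∘⟨ u-at-level-0)
    where
      u-at-level-0 : u ≈ inj 0 ∘ (∇ ∘ u)
      u-at-level-0 = pred-invariant⇒level-0 (refl⟩∘⟨ ≈-sym shift∘u≈u ○ cancelˡ pred∘shift)

module DelayProperties {o ℓ e : Level} (𝒞 : Category o ℓ e)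
  (fc : Definitions.FiniteCoproducts 𝒞) (ext : Definitions.IsExtensive 𝒞 fc)
  (fp : Definitions.FiniteProducts 𝒞) {X : Category.Obj 𝒞}
  (DX : Definitions.FinalCoalgebra 𝒞 fc X) where
  open Category 𝒞
  open Definitions 𝒞
  open Coprods fc
  open Prods fp using (𝟙; !)
  open FinalCoalgebra DX
  open HomReasoning 𝒞
  open CategoryProperties 𝒞
  open FiniteCoproductProperties 𝒞 fc
  open ExtensiveProperties 𝒞 fc ext
  open ProductProperties 𝒞 fp using (!-unique₂)

  X+D≅D : Iso (X + D) D
  X+D≅D = record { to = out⁻¹ ; from = out ; from∘to = out∘out⁻¹ ; to∘from = out⁻¹∘out }

  now-later-isCoproduct : IsCoproduct now later
  now-later-isCoproduct = IsCoproduct-transport +-isCoproduct X+D≅D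

  later-monic : Monic later
  later-monic = IsCoproduct⇒Monic₂ now-later-isCoproduct

  delay : ℕ → Hom X D
  delay i = iterate later i ∘ now

  delay-suc : ∀ i → delay (suc i) ≈ later ∘ delay i
  delay-suc i = assoc

  delay-complemented : ∀ i → Complemented (delay i)
  delay-complemented zero    =
    Complemented-resp-≈ identityˡ (IsCoproduct⇒Complemented₁ now-later-isCoproduct)
  delay-complemented (suc i) =
    Complemented-resp-≈ (delay-suc i)
      (Complemented-∘ (IsCoproduct⇒Complemented₂ now-later-isCoproduct) (delay-complemented i))

  delay-suc∘ : ∀ i {Q} {x : Hom Q X} → delay (suc i) ∘ x ≈ later ∘ (delay i ∘ x)
  delay-suc∘ i = delay-suc i ⟩∘⟨refl ○ assoc

  now-delay-disjoint : ∀ j → Disjoint now (delay (suc j))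
  now-delay-disjoint j x y eq =
    IsCoproduct⇒Disjoint now-later-isCoproduct x (delay j ∘ y) (eq ○ delay-suc∘ j)

  delay-disjoint : ∀ i j → i ≢ j → Disjoint (delay i) (delay j)
  delay-disjoint zero    zero    i≢j = ⊥-elim (i≢j refl)
  delay-disjoint zero    (suc j) _   x y eq =
    now-delay-disjoint j x y (≈-sym (identityˡ ⟩∘⟨refl) ○ eq)
  delay-disjoint (suc i) zero    _   =
    Disjoint-sym λ x y eq → now-delay-disjoint i x y (≈-sym (identityˡ ⟩∘⟨refl) ○ eq)
  delay-disjoint (suc i) (suc j) i≢j x y eq =
    delay-disjoint i j (λ i≡j → i≢j (cong suc i≡j)) x y
      (later-monic _ _ (≈-sym (delay-suc∘ i) ○ eq ○ delay-suc∘ j))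

  unfold-unique₂ : ∀ {Z} {c : Hom Z (X + Z)} {h h′ : Hom Z D} →
                   out ∘ h ≈ (id +₁ h) ∘ c → out ∘ h′ ≈ (id +₁ h′) ∘ c → h ≈ h′
  unfold-unique₂ {c = c} {h} {h′} p p′ =
    proj₂ (proj₂ (unfold c)) h p ○ ≈-sym (proj₂ (proj₂ (unfold c)) h′ p′)

  never : Hom 𝟙 D
  never = proj₁ (unfold inr)

  out∘never : out ∘ never ≈ inr ∘ never
  out∘never = proj₁ (proj₂ (unfold inr)) ○ []-inr

  later∘never : later ∘ never ≈ never
  later∘never = pullʳ (≈-sym out∘never) ○ cancelˡ out⁻¹∘out

  -- h and never ∘ ! are both coalgebra maps out of inr ∘ τ.
  later-invariant⇒never : ∀ {Z} {h : Hom Z D} (τ : Hom Z Z) → h ≈ later ∘ (h ∘ τ) → h ≈ never ∘ !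
  later-invariant⇒never τ h-invariant =
    unfold-unique₂ (coalgebra-map h-invariant) (coalgebra-map never!-invariant)
    where
      coalgebra-map : ∀ {k} → k ≈ later ∘ (k ∘ τ) → out ∘ k ≈ (id +₁ k) ∘ (inr ∘ τ)
      coalgebra-map p =
        refl⟩∘⟨ p ○ pullˡ (cancelˡ out∘out⁻¹) ○ sym-assoc ○ ≈-sym []-inr ⟩∘⟨refl ○ assoc
      never!-invariant : never ∘ ! ≈ later ∘ ((never ∘ !) ∘ τ)
      never!-invariant = ≈-sym (pullˡ later∘never) ○ refl⟩∘⟨ (refl⟩∘⟨ !-unique₂ _ _ ○ sym-assoc)

module DelayDecomposition {o ℓ e : Level} (𝒞 : Category o ℓ e)
  (fc : Definitions.FiniteCoproducts 𝒞) (ext : Definitions.IsExtensive 𝒞 fc)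
  (fp : Definitions.FiniteProducts 𝒞) (nno : Definitions.StableNNO 𝒞 fp)
  (cc : Definitions.CountableCoproducts 𝒞)
  (unions-complemented : Definitions.CountableUnionsComplemented 𝒞 fc cc)
  {X : Category.Obj 𝒞} (DX : Definitions.FinalCoalgebra 𝒞 fc X) where
  open Category 𝒞
  open Definitions 𝒞
  open Coprods fc
  open Prods fp
  open StableNNO nno
  open FinalCoalgebra DX
  open HomReasoning 𝒞
  open CategoryProperties 𝒞
  open FiniteCoproductProperties 𝒞 fc
  open ExtensiveProperties 𝒞 fc ext
  open ProductProperties 𝒞 fp
  open ConstantCoproduct 𝒞 (cc (λ _ → X))
  open ConstantCoproductNNO 𝒞 fp nno (cc (λ _ → X))
  open ShiftFixpoints 𝒞 fc ext fp nno (cc (λ _ → X))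
  open DelayProperties 𝒞 fc ext fp DX

  m : Hom ∐ D
  m = copair delay

  m-complemented : Complemented m
  m-complemented = unions-complemented (λ _ → X) D delay delay-complemented
    (λ i j i≢j → Disjoint⇒IsPullback (delay-disjoint i j i≢j))

  C′ : Obj
  C′ = proj₁ (proj₂ m-complemented)

  c′ : Hom C′ D
  c′ = proj₁ (proj₂ (proj₂ m-complemented))

  m-c′-isCoproduct : IsCoproduct m c′
  m-c′-isCoproduct = proj₂ (proj₂ (proj₂ m-complemented))

  m∘shift : m ∘ shift ≈ later ∘ m
  m∘shift = ∐-jointly-epic λ i →
    pullʳ (copair-inj i) ○ copair-inj (suc i) ○ delay-suc i ○ ≈-sym (pullʳ (copair-inj i))

  ι≈m∘X⊗N≅∐ : ι fc fp nno DX ≈ m ∘ Iso.to X⊗N≅∐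
  ι≈m∘X⊗N≅∐ = ≈-sym (rec-unique now later (m ∘ Iso.to X⊗N≅∐)
    (pullʳ (rec-z _ _) ○ copair-inj 0 ○ identityˡ)
    (pullʳ (rec-s _ _) ○ pullˡ m∘shift ○ assoc))

  ι-complemented : Complemented (ι fc fp nno DX)
  ι-complemented = Complemented-resp-≈ ι≈m∘X⊗N≅∐ (Complemented-∘-Iso m-complemented X⊗N≅∐)

  -- c′ avoids now = m ∘ inj 0, so c′ = later ∘ t; and t avoids m because
  -- later ∘ m = m ∘ shift, so t = c′ ∘ τ.
  c′≈never : c′ ≈ never ∘ !
  c′≈never = later-invariant⇒never τ (c′≈later∘t ○ refl⟩∘⟨ t≈c′∘τ)
    where
      m-c′-disjoint = IsCoproduct⇒Disjoint m-c′-isCoproduct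
      c′-avoids-now : Disjoint c′ now
      c′-avoids-now x y eq =
        m-c′-disjoint (inj 0 ∘ y) x (pullˡ (copair-inj 0) ○ identityˡ ⟩∘⟨refl ○ ≈-sym eq)
      t-factors = factor-through-complement now-later-isCoproduct c′ c′-avoids-now
      t = proj₁ t-factors
      c′≈later∘t = proj₂ t-factors
      t-avoids-m : Disjoint t m
      t-avoids-m x a eq = m-c′-disjoint (shift ∘ a) x (begin
        m ∘ (shift ∘ a)   ≈⟨ pullˡ m∘shift ○ assoc ⟩
        later ∘ (m ∘ a)   ≈⟨ refl⟩∘⟨ eq ⟨
        later ∘ (t ∘ x)   ≈⟨ c′≈later∘t ⟩∘⟨refl ○ assoc ⟨
        c′ ∘ x            ∎)
      τ-factors = factor-through-complement m-c′-isCoproduct t t-avoids-m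
      τ = proj₁ τ-factors
      t≈c′∘τ = proj₂ τ-factors

  -- never avoids m: a common point m ∘ a = never ∘ x would be fixed by shift.
  never-factors : Σ[ k ∈ Hom 𝟙 C′ ] never ≈ c′ ∘ k
  never-factors = factor-through-complement m-c′-isCoproduct never λ x a eq →
    shift-fixpoint⇒empty a (IsCoproduct⇒Monic₁ m-c′-isCoproduct _ _ (begin
      m ∘ (shift ∘ a)      ≈⟨ pullˡ m∘shift ○ assoc ⟩
      later ∘ (m ∘ a)      ≈⟨ refl⟩∘⟨ eq ⟨
      later ∘ (never ∘ x)  ≈⟨ pullˡ later∘never ⟩
      never ∘ x            ≈⟨ eq ⟩
      m ∘ a                ∎))

  C′≅𝟙 : Iso C′ 𝟙
  C′≅𝟙 = record
    { to      = !
    ; from    = proj₁ never-factors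
    ; from∘to = IsCoproduct⇒Monic₂ m-c′-isCoproduct _ _
        (pullˡ (≈-sym (proj₂ never-factors)) ○ ≈-sym c′≈never ○ ≈-sym identityʳ)
    ; to∘from = !-unique₂ _ _
    }

  D≅X⊗N+𝟙 : Iso D ((X ⊗ N) + 𝟙)
  D≅X⊗N+𝟙 = IsCoproduct⇒Iso m-c′-isCoproduct (Iso-sym X⊗N≅∐) C′≅𝟙

corollary3p4 : ∀ {o ℓ e : Level} (𝒞 : Category o ℓ e)
    (fc : Definitions.FiniteCoproducts 𝒞)
    (ext : Definitions.IsExtensive 𝒞 fc)
    (fp : Definitions.FiniteProducts 𝒞)
    (nno : Definitions.StableNNO 𝒞 fp)
    (exps : Definitions.HasExponentialsN 𝒞 fp nno)
    (cc : Definitions.CountableCoproducts 𝒞)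
    (hyp-ii : Definitions.CountableUnionsComplemented 𝒞 fc cc) →
    (∀ (N̄ : Definitions.FinalCoalgebra 𝒞 fc (Definitions.FiniteProducts.𝟙 fp)) →
       Definitions.Complemented 𝒞 (Definitions.ιhat 𝒞 fc fp nno N̄))
    ×
    (∀ (X : Category.Obj 𝒞) (DX : Definitions.FinalCoalgebra 𝒞 fc X) →
       Definitions.Iso 𝒞 (Definitions.FinalCoalgebra.D DX)
         (Definitions.Coprods._+_ 𝒞 fc
           (Definitions.Prods._⊗_ 𝒞 fp X (Definitions.StableNNO.N nno))
           (Definitions.FiniteProducts.𝟙 fp)))
corollary3p4 𝒞 fc ext fp nno _ cc hyp-ii =
  (λ N̄ → Complemented-∘-Iso (Decomposition.ι-complemented N̄) N≅𝟙⊗N) ,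
  (λ _ DX → Decomposition.D≅X⊗N+𝟙 DX)
  where
    open CategoryProperties 𝒞 using (Complemented-∘-Iso)
    open NNOProperties 𝒞 fp nno using (N≅𝟙⊗N)
    module Decomposition = DelayDecomposition 𝒞 fc ext fp nno cc hyp-ii
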